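{- With the notation of the context, for every $l\in\{3,\dots,m+3\}$ there is no integer $k$ with $4\le k\le m+2$ such that $v_{l,k}=a_k$, $v_{l,k-1}<a_{k-1}$, $v_{l,k-2}=a_{k-2}$ and $v_{l,k-3}>0$.
   Context: Let $a$ be a real number with infinite continued fraction expansion $[a_0;a_1,a_2,\dots]$ ($a_0\in\mathbb{Z}$, $a_i$ positive integers for $i\ge1$). Set $q_{ -1}=0$, $q_0=1$, $q_{k+1}=a_{k+1}q_k+q_{k-1}$. The Ostrowski representation of $N\in\mathbb{N}$ is the unique word $b_n\dots b_1$ with $N=\sum_{k=0}^{n}b_{k+1}q_k$, $b_k\in\mathbb{N}$, $b_1<a_1$, $b_k\le a_k$, and $b_{k-1}=0$ whenever $b_k=a_k$. A word is written $u_r\dots u_1$; $u_i$ is the entry at position $i$. Let $M,N\in\mathbb{N}$ have Ostrowski representations $x_n\dots x_1$, $y_n\dots y_1$ (padded with leading zeros to common length $n$). Let $m=n+1$, $s_i=x_i+y_i$ ($1\le i\le n$), $s_m=0$, $s=s_m\dots s_1$. Algorithm 1 defines $z_k=z_{k,m}\dots z_{k,1}$ for $k=m+1,\dots,3$ (decreasing). $z_{m+1}=s$. For $4\le k\le m$: $z_{k,i}=z_{k+1,i}$ for $i\notin\{k,k-1,k-2,k-3\}$, and (A1) if $z_{k+1,k}<a_k$, $z_{k+1,k-1}>a_{k-1}$, $z_{k+1,k-2}=0$: $(z_{k,k},z_{k,k-1},z_{k,k-2},z_{k,k-3})=(z_{k+1,k}+1,\ z_{k+1,k-1}-(a_{k-1}+1),\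 a_{k-2}-1,\ z_{k+1,k-3}+1)$; (A2) if $z_{k+1,k}<a_k$, $a_{k-1}\le z_{k+1,k-1}\le 2a_{k-1}$, $z_{k+1,k-2}>0$: $(z_{k+1,k}+1,\ z_{k+1,k-1}-a_{k-1},\ z_{k+1,k-2}-1,\ z_{k+1,k-3})$; (A3) otherwise unchanged. For $k=3$: $z_{3,i}=z_{4,i}$ for $i\notin\{1,2,3\}$, and (B1) if $z_{4,3}<a_3$, $z_{4,2}>a_2$, $z_{4,1}=0$: $(z_{3,3},z_{3,2},z_{3,1})=(z_{4,3}+1,\ z_{4,2}-(a_2+1),\ a_1-1)$; (B2) if $z_{4,3}<a_3$, $z_{4,2}\ge a_2$, $a_1\ge z_{4,1}>0$: $(z_{4,3}+1,\ z_{4,2}-a_2,\ z_{4,1}-1)$; (B3) if $z_{4,3}<a_3$, $z_{4,2}\ge a_2$, $z_{4,1}>a_1$: $(z_{4,3}+1,\ z_{4,2}-a_2+1,\ z_{4,1}-a_1-1)$; (B4) if $z_{4,2}<a_2$, $z_{4,1}\ge a_1$: $(z_{4,3},\ z_{4,2}+1,\ z_{4,1}-a_1)$; (B5) otherwise unchanged. Algorithm 2 defines $w_k=w_{k,m+1}\dots w_{k,1}$ for $k=2,\dots,m+1$ (increasing). $w_2=0\,z_{3,m}\dots z_{3,1}$. For $3\le k\le m+1$: $w_{k,i}=w_{k-1,i}$ for $i\notin\{k,k-1,k-2\}$; if $w_{k-1,k}<a_k$, $w_{k-1,k-1}=a_{k-1}$, $w_{k-1,k-2}>0$, then $(w_{k,k},w_{k,k-1},w_{k,k-2})=(w_{k-1,k}+1,\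 0,\ w_{k-1,k-2}-1)$; otherwise unchanged. Algorithm 3 defines $v_k=v_{k,m+2}\dots v_{k,1}$ for $k=m+3,m+2,\dots,3$ (decreasing). $v_{m+3}=0\,w_{m+1,m+1}\dots w_{m+1,1}$. For $3\le k\le m+2$: $v_{k,i}=v_{k+1,i}$ for $i\notin\{k,k-1,k-2\}$; if $v_{k+1,k}<a_k$, $v_{k+1,k-1}=a_{k-1}$, $v_{k+1,k-2}>0$, then $(v_{k,k},v_{k,k-1},v_{k,k-2})=(v_{k+1,k}+1,\ 0,\ v_{k+1,k-2}-1)$; otherwise unchanged. -}

module Defs where

open import Data.Nat using (ℕ; zero; suc; _+_; _*_; _∸_; _≤_; _<_; _<ᵇ_; _≤ᵇ_; _≡ᵇ_)
open import Data.Bool using (Bool; true; false; _∧_; if_then_else_)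
open import Data.Product using (_×_)
open import Relation.Binary.PropositionalEquality using (_≡_)

-- A word is a function from positions to ℕ; position i ≥ 1 holds u_i.
Word : Set
Word = ℕ → ℕ

-- Continuants: q k = q_k (q_{-1} = 0, q_0 = 1, q_{k+1} = a_{k+1} q_k + q_{k-1}).
q : (ℕ → ℕ) → ℕ → ℕ
q a zero = 1
q a (suc zero) = a 1 * 1 + 0
q a (suc (suc k)) = a (suc (suc k)) * q a (suc k) + q a k

value : (ℕ → ℕ) → ℕ → Word → ℕ
value a zero b = 0
value a (suc n) b = value a n b + b (suc n) * q a n

-- b_n … b_1 (possibly with leading zeros) is the Ostrowski representation of N
record OstrowskiRep (a : ℕ → ℕ) (n : ℕ) (b : Word) (N : ℕ) : Set where
  field
    val   : N ≡ value a n b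
    first : 1 ≤ n → b 1 < a 1
    bound : ∀ k → 1 ≤ k → k ≤ n → b k ≤ a k
    zeroAfterMax : ∀ k → 2 ≤ k → k ≤ n → b k ≡ a k → b (k ∸ 1) ≡ 0

upd : Word → ℕ → ℕ → Word
upd f p c i = if i ≡ᵇ p then c else f i

trunc : ℕ → Word → Word
trunc r f i = if (1 ≤ᵇ i) ∧ (i ≤ᵇ r) then f i else 0

-- s = s_m … s_1 with s_i = x_i + y_i (1 ≤ i ≤ n), s_m = 0
sumWord : ℕ → Word → Word → Word
sumWord n x y = trunc n (λ i → x i + y i)

-- one step of Algorithm 1 at index k ≥ 4 (rules A1–A3)
stepA : (ℕ → ℕ) → ℕ → Word → Word
stepA a k f =
  if (f k <ᵇ a k) ∧ (a (k ∸ 1) <ᵇ f (k ∸ 1)) ∧ (f (k ∸ 2) ≡ᵇ 0)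
  then upd (upd (upd (upd f k (f k + 1)) (k ∸ 1) (f (k ∸ 1) ∸ (a (k ∸ 1) + 1)))
             (k ∸ 2) (a (k ∸ 2) ∸ 1)) (k ∸ 3) (f (k ∸ 3) + 1)
  else if (f k <ᵇ a k) ∧ (a (k ∸ 1) ≤ᵇ f (k ∸ 1)) ∧ (f (k ∸ 1) ≤ᵇ 2 * a (k ∸ 1))
          ∧ (0 <ᵇ f (k ∸ 2))
  then upd (upd (upd f k (f k + 1)) (k ∸ 1) (f (k ∸ 1) ∸ a (k ∸ 1)))
             (k ∸ 2) (f (k ∸ 2) ∸ 1)
  else f

-- the step of Algorithm 1 at k = 3 (rules B1–B5)
stepB : (ℕ → ℕ) → Word → Word
stepB a f =
  if (f 3 <ᵇ a 3) ∧ (a 2 <ᵇ f 2) ∧ (f 1 ≡ᵇ 0)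
  then upd (upd (upd f 3 (f 3 + 1)) 2 (f 2 ∸ (a 2 + 1))) 1 (a 1 ∸ 1)
  else if (f 3 <ᵇ a 3) ∧ (a 2 ≤ᵇ f 2) ∧ (f 1 ≤ᵇ a 1) ∧ (0 <ᵇ f 1)
  then upd (upd (upd f 3 (f 3 + 1)) 2 (f 2 ∸ a 2)) 1 (f 1 ∸ 1)
  else if (f 3 <ᵇ a 3) ∧ (a 2 ≤ᵇ f 2) ∧ (a 1 <ᵇ f 1)
  then upd (upd (upd f 3 (f 3 + 1)) 2 ((f 2 ∸ a 2) + 1)) 1 ((f 1 ∸ a 1) ∸ 1)
  else if (f 2 <ᵇ a 2) ∧ (a 1 ≤ᵇ f 1)
  then upd (upd f 2 (f 2 + 1)) 1 (f 1 ∸ a 1)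
  else f

step1 : (ℕ → ℕ) → ℕ → Word → Word
step1 a k f = if k ≡ᵇ 3 then stepB a f else stepA a k f

-- step of Algorithms 2 and 3 at index k
step2 : (ℕ → ℕ) → ℕ → Word → Word
step2 a k f =
  if (f k <ᵇ a k) ∧ (f (k ∸ 1) ≡ᵇ a (k ∸ 1)) ∧ (0 <ᵇ f (k ∸ 2))
  then upd (upd (upd f k (f k + 1)) (k ∸ 1) 0) (k ∸ 2) (f (k ∸ 2) ∸ 1)
  else f

module _ (a : ℕ → ℕ) (n : ℕ) (x y : Word) where
  m : ℕ
  m = suc n

  -- zIter j = z_{m+1-j}
  zIter : ℕ → Word
  zIter zero = sumWord n x y
  zIter (suc j) = step1 a (m ∸ j) (zIter j)

  z3 : Word
  z3 = zIter (m ∸ 2)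

  -- wIter j = w_{2+j}
  wIter : ℕ → Word
  wIter zero = trunc m z3
  wIter (suc j) = step2 a (3 + j) (wIter j)

  wLast : Word
  wLast = wIter (m ∸ 1)

  -- vIter j = v_{m+3-j}
  vIter : ℕ → Word
  vIter zero = trunc (m + 1) wLast
  vIter (suc j) = step2 a ((m + 2) ∸ j) (vIter j)

  -- v l = v_l  (3 ≤ l ≤ m+3)
  v : ℕ → Word
  v l = vIter ((m + 3) ∸ l)

module Submission where

-- Proof strategy.  Write s for the digit sum of the two Ostrowski representations.
--
--  * Digits of an Ostrowski representation are bounded by the partial quotients, and a
--    maximal digit is followed by 0.  Hence s_i ≤ 2a_i, and s_{i+1} = 2a_{i+1} (resp.
--    2a_{i+1} − 1) forces s_i = 0 (resp. s_i ≤ a_i)                      (DigitSum).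
--  * Algorithm 1: after its steps at m, …, 4+t, the digits from position 3+t on are
--    bounded by the partial quotients, positions 2+t and 1+t are in one of four explicitly
--    described states relative to s, and lower positions still agree with s
--    (Alg1Invariant).  The final step at index 3 yields z₃ bounded from position 2 on.
--  * Algorithms 2 and 3 apply a single rule.  On a bounded word it keeps the word bounded
--    and creates no forbidden pattern, except for moving a pattern at 4+t up to 6+t
--    (pattern-after-step2).  Hence Algorithm 2 turns z₃ into a pattern-free ("clean")
--    word, every step of Algorithm 3 keeps it clean, and the theorem follows.

open import Defs
open import Data.Nat using (ℕ; zero; suc; _+_; _*_; _∸_; _≤_; _<_; _<ᵇ_; _≤ᵇ_; _≡ᵇ_;
                            _≟_; _≤?_; z≤n; s≤s; s≤s⁻¹)
open import Data.Nat.Properties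
open import Data.Bool using (_∧_; if_then_else_)
open import Data.Product using (Σ; _×_; _,_; proj₁; proj₂)
open import Data.Sum using (_⊎_; inj₁; inj₂)
open import Relation.Binary.PropositionalEquality
open import Relation.Nullary using (¬_; _because_; yes; no; contradiction)
open import Relation.Nullary.Reflects using (Reflects; ofʸ; ofⁿ; _×-reflects_; fromEquivalence)

≡ᵇ-reflects-≡ : ∀ m n → Reflects (m ≡ n) (m ≡ᵇ n)
≡ᵇ-reflects-≡ m n = fromEquivalence (≡ᵇ⇒≡ m n) (≡⇒≡ᵇ m n)

if-holds : ∀ {P A : Set} {b} {x y : A} → Reflects P b → P → (if b then x else y) ≡ x
if-holds (ofʸ _)  _ = refl
if-holds (ofⁿ ¬p) p = contradiction p ¬p

if-fails : ∀ {P A : Set} {b} {x y : A} → Reflects P b → ¬ P → (if b then x else y) ≡ y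
if-fails (ofʸ p) ¬p = contradiction p ¬p
if-fails (ofⁿ _) _  = refl

upd-same : ∀ f p c → upd f p c p ≡ c
upd-same f p c = if-holds (≡ᵇ-reflects-≡ p p) refl

upd-other : ∀ f p c {i} → i ≢ p → upd f p c i ≡ f i
upd-other f p c {i} i≢p = if-fails (≡ᵇ-reflects-≡ i p) i≢p

trunc-inside : ∀ r f {i} → 1 ≤ i → i ≤ r → trunc r f i ≡ f i
trunc-inside r f {i} 1≤i i≤r =
  if-holds (≤ᵇ-reflects-≤ 1 i ×-reflects ≤ᵇ-reflects-≤ i r) (1≤i , i≤r)

trunc-outside : ∀ r f {i} → r < i → trunc r f i ≡ 0
trunc-outside r f {i} r<i =
  if-fails (≤ᵇ-reflects-≤ 1 i ×-reflects ≤ᵇ-reflects-≤ i r) (λ (_ , i≤r) → <⇒≱ r<i i≤r)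

data Position (t : ℕ) : ℕ → Set where
  below : ∀ {i} → i ≤ t → Position t i
  above : ∀ d → Position t (suc (d + t))

position : ∀ t i → Position t i
position t i with i ≤? t
... | yes i≤t = below i≤t
... | no  i≰t = subst (Position t) i-as-offset (above (i ∸ suc t))
  where
  i-as-offset : suc (i ∸ suc t + t) ≡ i
  i-as-offset = trans (sym (+-suc (i ∸ suc t) t)) (m∸n+n≡m (≰⇒> i≰t))

Outside : ℕ → ℕ → ℕ → Set
Outside t w i = i ≤ t ⊎ w + t < i

AgreeOutside : ℕ → ℕ → Word → Word → Set
AgreeOutside t w W N = ∀ i → Outside t w i → N i ≡ W i

outside-≢ : ∀ {t w i} j → 1 ≤ j → j ≤ w → Outside t w i → i ≢ j + t
outside-≢ {t} j 1≤j j≤w (inj₁ i≤t)   = <⇒≢ (≤-trans (s≤s i≤t) (+-monoˡ-≤ t 1≤j))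
outside-≢ {t} j 1≤j j≤w (inj₂ w+t<i) = >⇒≢ (≤-<-trans (+-monoˡ-≤ t j≤w) w+t<i)

outside-shrink : ∀ {t w i} → Outside t (suc w) i → Outside t w i
outside-shrink (inj₁ i≤t)     = inj₁ i≤t
outside-shrink (inj₂ 1+w+t<i) = inj₂ (<-trans (n<1+n _) 1+w+t<i)

-- Overwriting positions w+t, …, 1+t of a word, highest first: every rule of the three
-- algorithms has this shape.
module _ (t : ℕ) where
  overwrite₂ : Word → ℕ → ℕ → Word
  overwrite₂ W c₂ c₁ = upd (upd W (2 + t) c₂) (1 + t) c₁

  overwrite₃ : Word → ℕ → ℕ → ℕ → Word
  overwrite₃ W c₃ = overwrite₂ (upd W (3 + t) c₃)

  overwrite₄ : Word → ℕ → ℕ → ℕ → ℕ → Word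
  overwrite₄ W c₄ = overwrite₃ (upd W (4 + t) c₄)

record Overwritten₂ (t : ℕ) (W N : Word) (c₂ c₁ : ℕ) : Set where
  field
    at₂     : N (2 + t) ≡ c₂
    at₁     : N (1 + t) ≡ c₁
    outside : AgreeOutside t 2 W N

record Overwritten₃ (t : ℕ) (W N : Word) (c₃ c₂ c₁ : ℕ) : Set where
  field
    at₃     : N (3 + t) ≡ c₃
    at₂     : N (2 + t) ≡ c₂
    at₁     : N (1 + t) ≡ c₁
    outside : AgreeOutside t 3 W N

record Overwritten₄ (t : ℕ) (W N : Word) (c₄ c₃ c₂ c₁ : ℕ) : Set where
  field
    at₄     : N (4 + t) ≡ c₄
    at₃     : N (3 + t) ≡ c₃
    at₂     : N (2 + t) ≡ c₂
    at₁     : N (1 + t) ≡ c₁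
    outside : AgreeOutside t 4 W N

overwrite₂-spec : ∀ t W c₂ c₁ → Overwritten₂ t W (overwrite₂ t W c₂ c₁) c₂ c₁
overwrite₂-spec t W c₂ c₁ = record
  { at₂     = trans (upd-other W₂ (1 + t) c₁ (>⇒≢ ≤-refl)) (upd-same W (2 + t) c₂)
  ; at₁     = upd-same W₂ (1 + t) c₁
  ; outside = λ i out → trans (upd-other W₂ (1 + t) c₁ (outside-≢ 1 ≤-refl (s≤s z≤n) out))
                              (upd-other W (2 + t) c₂ (outside-≢ 2 (s≤s z≤n) ≤-refl out))
  }
  where
  W₂ : Word
  W₂ = upd W (2 + t) c₂

overwrite₃-spec : ∀ t W c₃ c₂ c₁ → Overwritten₃ t W (overwrite₃ t W c₃ c₂ c₁) c₃ c₂ c₁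
overwrite₃-spec t W c₃ c₂ c₁ = record
  { at₃     = trans (outside (3 + t) (inj₂ ≤-refl)) (upd-same W (3 + t) c₃)
  ; at₂     = at₂
  ; at₁     = at₁
  ; outside = λ i out → trans (outside i (outside-shrink out))
                              (upd-other W (3 + t) c₃ (outside-≢ 3 (s≤s z≤n) ≤-refl out))
  }
  where open Overwritten₂ (overwrite₂-spec t (upd W (3 + t) c₃) c₂ c₁)

overwrite₄-spec : ∀ t W c₄ c₃ c₂ c₁ →
                  Overwritten₄ t W (overwrite₄ t W c₄ c₃ c₂ c₁) c₄ c₃ c₂ c₁
overwrite₄-spec t W c₄ c₃ c₂ c₁ = record
  { at₄     = trans (outside (4 + t) (inj₂ ≤-refl)) (upd-same W (4 + t) c₄)
  ; at₃     = at₃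
  ; at₂     = at₂
  ; at₁     = at₁
  ; outside = λ i out → trans (outside i (outside-shrink out))
                              (upd-other W (4 + t) c₄ (outside-≢ 4 (s≤s z≤n) ≤-refl out))
  }
  where open Overwritten₃ (overwrite₃-spec t (upd W (4 + t) c₄) c₃ c₂ c₁)

<⇒+1≤ : ∀ {z b} → z < b → z + 1 ≤ b
<⇒+1≤ {z} {b} z<b = subst (_≤ b) (+-comm 1 z) z<b

pred-< : ∀ {z b} → 0 < z → z ≤ b → z ∸ 1 < b
pred-< {suc z} _ z≤b = z≤b

suc-∸1 : ∀ {b} → 1 ≤ b → suc (b ∸ 1) ≡ b
suc-∸1 {suc b} _ = refl

-- Rule A2 is phrased with 2 * b; we compute with b + b.
double : ∀ b → 2 * b ≡ b + b
double b = cong (b +_) (+-identityʳ b)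

≤-double : ∀ b → b ≤ 2 * b
≤-double b = m≤m+n b (b + 0)

-- Subtracting b (or b + 1, or b and adding 1) from a number of size about 2b leaves at
-- most b: the new digits produced by rules A1, A2, B1–B3 are bounded.
∸-≤-half : ∀ {z b} → z ≤ 2 * b → z ∸ b ≤ b
∸-≤-half {z} {b} z≤2b = m≤n+o⇒m∸n≤o z b (subst (z ≤_) (double b) z≤2b)

∸-suc-≤-half : ∀ {z b} → z ≤ suc (2 * b) → z ∸ (b + 1) ≤ b
∸-suc-≤-half {z} {b} z≤1+2b = m≤n+o⇒m∸n≤o z (b + 1) (subst (z ≤_) 1+2b≡b+1+b z≤1+2b)
  where
  1+2b≡b+1+b : suc (2 * b) ≡ b + 1 + b
  1+2b≡b+1+b = trans (cong suc (double b)) (trans (sym (+-suc b b)) (sym (+-assoc b 1 b)))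

∸-+1-≤-half : ∀ {z b} → b ≤ z → z < 2 * b → (z ∸ b) + 1 ≤ b
∸-+1-≤-half {z} {b} b≤z z<2b =
  subst (_≤ b) (+-∸-comm 1 b≤z) (m≤n+o⇒m∸n≤o (z + 1) b (subst₂ _≤_ (+-comm 1 z) (double b) z<2b))

∸-≡⇒double : ∀ {z b} → b ≤ z → z ∸ b ≡ b → z ≡ 2 * b
∸-≡⇒double {z} {b} b≤z z∸b≡b =
  trans (sym (m∸n+n≡m b≤z)) (trans (cong (_+ b) z∸b≡b) (sym (double b)))

sum-max : ∀ {u v b} → u ≤ b → v ≤ b → u + v ≡ b + b → u ≡ b
sum-max u≤b v≤b u+v≡2b with m≤n⇒m<n∨m≡n u≤b
... | inj₂ u≡b = u≡b
... | inj₁ u<b = contradiction u+v≡2b (<⇒≢ (+-mono-<-≤ u<b v≤b))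

sum-max-pred : ∀ {u v b} → u ≤ b → v ≤ b → suc (u + v) ≡ b + b → u ≡ b ⊎ v ≡ b
sum-max-pred {u} {v} {b} u≤b v≤b 1+u+v≡2b with m≤n⇒m<n∨m≡n u≤b | m≤n⇒m<n∨m≡n v≤b
... | inj₂ u≡b | _        = inj₁ u≡b
... | inj₁ _   | inj₂ v≡b = inj₂ v≡b
... | inj₁ u<b | inj₁ v<b =
  contradiction 1+u+v≡2b (<⇒≢ (subst (_≤ b + b) (cong suc (+-suc u v)) (+-mono-≤ u<b v<b)))

offset-∸ : ∀ c j r → c + (j + r) ∸ j ≡ c + r
offset-∸ c zero    r = refl
offset-∸ c (suc j) r = trans (cong (_∸ suc j) (+-suc c (j + r))) (offset-∸ c j r)

record Admissible (a : ℕ → ℕ) (d : Word) : Set where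
  field
    digit-≤        : ∀ i → d i ≤ a i
    zero-after-max : ∀ i → d (2 + i) ≡ a (2 + i) → d (1 + i) ≡ 0

ostrowski-admissible : ∀ {a n x M} → (∀ i → 1 ≤ i → 1 ≤ a i) → OstrowskiRep a n x M →
                       Admissible a (trunc n x)
ostrowski-admissible {a} {n} {x} a-pos rep =
  record { digit-≤ = digit-≤ ; zero-after-max = zero-after-max }
  where
  open OstrowskiRep rep
  digit-≤ : ∀ i → trunc n x i ≤ a i
  digit-≤ zero = z≤n
  digit-≤ (suc i) with suc i ≤? n
  ... | yes i<n = subst (_≤ a (suc i)) (sym (trunc-inside n x (s≤s z≤n) i<n))
                        (bound (suc i) (s≤s z≤n) i<n)
  ... | no  i≮n = subst (_≤ a (suc i)) (sym (trunc-outside n x (≰⇒> i≮n))) z≤n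
  zero-after-max : ∀ i → trunc n x (2 + i) ≡ a (2 + i) → trunc n x (1 + i) ≡ 0
  zero-after-max i max with 2 + i ≤? n
  ... | yes 2+i≤n = trans (trunc-inside n x (s≤s z≤n) (≤-trans (n≤1+n _) 2+i≤n))
                      (zeroAfterMax (2 + i) (s≤s (s≤s z≤n)) 2+i≤n
                        (trans (sym (trunc-inside n x (s≤s z≤n) 2+i≤n)) max))
  ... | no  2+i≰n = contradiction (trans (sym (trunc-outside n x (≰⇒> 2+i≰n))) max)
                                  (<⇒≢ (a-pos (2 + i) (s≤s z≤n)))

record DigitSum (a : ℕ → ℕ) (S : Word) : Set where
  field
    sum-≤           : ∀ i → S i ≤ 2 * a i
    sum-full        : ∀ i → S (2 + i) ≡ 2 * a (2 + i) → S (1 + i) ≡ 0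
    sum-almost-full : ∀ i → suc (S (2 + i)) ≡ 2 * a (2 + i) → S (1 + i) ≤ a (1 + i)

admissible-sum : ∀ {a d e S} → Admissible a d → Admissible a e → (∀ i → S i ≡ d i + e i) →
                 DigitSum a S
admissible-sum {a} {d} {e} {S} ad ae S≡d+e = record
  { sum-≤ = λ i → subst₂ _≤_ (sym (S≡d+e i)) (sym (double (a i)))
                          (+-mono-≤ (D.digit-≤ i) (E.digit-≤ i))
  ; sum-full = sum-full
  ; sum-almost-full = sum-almost-full
  }
  where
  module D = Admissible ad
  module E = Admissible ae

  sum-full : ∀ i → S (2 + i) ≡ 2 * a (2 + i) → S (1 + i) ≡ 0
  sum-full i full =
    trans (S≡d+e (1 + i)) (cong₂ _+_ (D.zero-after-max i d-max) (E.zero-after-max i e-max))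
    where
    d+e≡2a : d (2 + i) + e (2 + i) ≡ a (2 + i) + a (2 + i)
    d+e≡2a = trans (sym (S≡d+e (2 + i))) (trans full (double (a (2 + i))))
    d-max : d (2 + i) ≡ a (2 + i)
    d-max = sum-max (D.digit-≤ _) (E.digit-≤ _) d+e≡2a
    e-max : e (2 + i) ≡ a (2 + i)
    e-max = sum-max (E.digit-≤ _) (D.digit-≤ _) (trans (+-comm (e (2 + i)) (d (2 + i))) d+e≡2a)

  sum-almost-full : ∀ i → suc (S (2 + i)) ≡ 2 * a (2 + i) → S (1 + i) ≤ a (1 + i)
  sum-almost-full i almost
    with sum-max-pred (D.digit-≤ _) (E.digit-≤ _)
                      (trans (cong suc (sym (S≡d+e (2 + i)))) (trans almost (double (a (2 + i)))))
  ... | inj₁ d-max = subst (_≤ a (1 + i))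
                       (sym (trans (S≡d+e (1 + i)) (cong (_+ e (1 + i)) (D.zero-after-max i d-max))))
                       (E.digit-≤ (1 + i))
  ... | inj₂ e-max = subst (_≤ a (1 + i))
                       (sym (trans (S≡d+e (1 + i))
                                   (trans (cong (d (1 + i) +_) (E.zero-after-max i e-max)) (+-identityʳ _))))
                       (D.digit-≤ (1 + i))

sumWord-split : ∀ n x y i → sumWord n x y i ≡ trunc n x i + trunc n y i
sumWord-split n x y zero = refl
sumWord-split n x y (suc i) with suc i ≤? n
... | yes i<n = trans (trunc-inside n (λ j → x j + y j) (s≤s z≤n) i<n)
                      (sym (cong₂ _+_ (trunc-inside n x (s≤s z≤n) i<n)
                                      (trunc-inside n y (s≤s z≤n) i<n)))
... | no  i≮n = trans (trunc-outside n (λ j → x j + y j) (≰⇒> i≮n))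
                      (sym (cong₂ _+_ (trunc-outside n x (≰⇒> i≮n)) (trunc-outside n y (≰⇒> i≮n))))

module Digits (a : ℕ → ℕ) (a-pos : ∀ i → 1 ≤ i → 1 ≤ a i) where

  zero-not-max : ∀ {i} → 1 ≤ i → 0 ≢ a i
  zero-not-max {i} 1≤i = <⇒≢ (a-pos i 1≤i)

  Bounded : Word → Set
  Bounded W = ∀ i → 2 ≤ i → W i ≤ a i

  trunc-bounded : ∀ r {f} → Bounded f → Bounded (trunc r f)
  trunc-bounded r {f} bnd i 2≤i with i ≤? r
  ... | yes i≤r = subst (_≤ a i) (sym (trunc-inside r f (≤-trans (n≤1+n 1) 2≤i) i≤r)) (bnd i 2≤i)
  ... | no  i≰r = subst (_≤ a i) (sym (trunc-outside r f (≰⇒> i≰r))) z≤n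

  bound-from : ∀ {p} {N Z : Word} → N p ≤ a p → N (1 + p) ≤ a (1 + p) →
               (∀ i → 1 + p < i → N i ≡ Z i) → (∀ i → 1 + p ≤ i → Z i ≤ a i) →
               ∀ i → p ≤ i → N i ≤ a i
  bound-from N-p N-1+p agree Z-bounded i p≤i with m≤n⇒m<n∨m≡n p≤i
  ... | inj₂ refl = N-p
  ... | inj₁ p<i with m≤n⇒m<n∨m≡n p<i
  ...   | inj₂ refl  = N-1+p
  ...   | inj₁ 1+p<i = subst (_≤ a i) (sym (agree i 1+p<i)) (Z-bounded i (<⇒≤ 1+p<i))

  Pattern : Word → ℕ → Set
  Pattern W k = W k ≡ a k × W (k ∸ 1) < a (k ∸ 1) × W (k ∸ 2) ≡ a (k ∸ 2) × 0 < W (k ∸ 3)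

  PatternFree : ℕ → Word → Set
  PatternFree M W = ∀ j → 4 ≤ j → j ≤ M → ¬ Pattern W j

  Clean : ℕ → Word → Set
  Clean M W = Bounded W × PatternFree M W

  pattern-transport : ∀ (N W : Word) j → (∀ d → d ≤ 3 → N (j ∸ d) ≡ W (j ∸ d)) →
                      Pattern N j → Pattern W j
  pattern-transport N W j agree (max₀ , lt₁ , max₂ , pos₃) =
    trans (sym (agree 0 z≤n)) max₀ ,
    subst (_< _) (agree 1 (s≤s z≤n)) lt₁ ,
    trans (sym (agree 2 (s≤s (s≤s z≤n)))) max₂ ,
    subst (0 <_) (agree 3 ≤-refl) pos₃

  trunc-pattern : ∀ r f j → 4 ≤ j → j ≤ r → Pattern (trunc r f) j → Pattern f j
  trunc-pattern r f j 4≤j j≤r = pattern-transport (trunc r f) f j λ d d≤3 →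
    trunc-inside r f (m+n≤o⇒m≤o∸n 1 (≤-trans (s≤s d≤3) 4≤j)) (≤-trans (m∸n≤m j d) j≤r)

module Algorithm1 (a : ℕ → ℕ) (a-pos : ∀ i → 1 ≤ i → 1 ≤ a i) (S : Word) (sum : DigitSum a S) where
  open Digits a a-pos
  open DigitSum sum

  -- The possible states of positions 2+t and 1+t after the steps at indices ≥ 4+t: rule A1
  -- has just fired (carried), rule A2 has just fired (borrowed), nothing changed them
  -- (untouched), or rule A1 fired at the previous index and rule A3 at the current one
  -- (received).
  data Frontier (t : ℕ) (Z : Word) : Set where
    carried   : suc (Z (2 + t)) ≡ a (2 + t) → Z (1 + t) ≡ suc (S (1 + t)) → Frontier t Z
    borrowed  : suc (Z (2 + t)) ≡ S (2 + t) → Z (1 + t) ≡ S (1 + t)       → Frontier t Z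
    untouched : Z (2 + t) ≡ S (2 + t)       → Z (1 + t) ≡ S (1 + t)       → Frontier t Z
    received  : Z (2 + t) ≡ suc (S (2 + t)) → Z (1 + t) ≡ S (1 + t)       → Frontier t Z

  module _ {t : ℕ} {Z : Word} where
    frontier-≤ : Frontier t Z → Z (2 + t) ≤ suc (2 * a (2 + t))
    frontier-≤ (carried 1+z≡a _)   = ≤-trans (<⇒≤ (≤-reflexive 1+z≡a)) (m≤n⇒m≤1+n (≤-double _))
    frontier-≤ (borrowed 1+z≡S _)  = ≤-trans (<⇒≤ (≤-reflexive 1+z≡S)) (m≤n⇒m≤1+n (sum-≤ _))
    frontier-≤ (untouched z≡S _)   = ≤-trans (≤-reflexive z≡S) (m≤n⇒m≤1+n (sum-≤ _))
    frontier-≤ (received z≡1+S _)  = ≤-trans (≤-reflexive z≡1+S) (s≤s (sum-≤ _))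

    frontier-≤-double : Frontier t Z → 0 < Z (1 + t) → Z (2 + t) ≤ 2 * a (2 + t)
    frontier-≤-double (carried 1+z≡a _) _    = ≤-trans (<⇒≤ (≤-reflexive 1+z≡a)) (≤-double _)
    frontier-≤-double (borrowed 1+z≡S _) _   = ≤-trans (<⇒≤ (≤-reflexive 1+z≡S)) (sum-≤ _)
    frontier-≤-double (untouched z≡S _) _  = ≤-trans (≤-reflexive z≡S) (sum-≤ _)
    frontier-≤-double (received z≡1+S low) pos with m≤n⇒m<n∨m≡n (sum-≤ (2 + t))
    ... | inj₁ S<2a = ≤-trans (≤-reflexive z≡1+S) S<2a
    ... | inj₂ S≡2a = contradiction (trans low (sum-full t S≡2a)) (>⇒≢ pos)

    frontier-double : Frontier t Z → Z (2 + t) ≡ 2 * a (2 + t) → 0 < Z (1 + t) →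
                      Z (1 + t) ≤ a (1 + t)
    frontier-double (carried 1+z≡a _) z≡2a _ =
      contradiction (trans (cong suc (sym z≡2a)) 1+z≡a) (>⇒≢ (s≤s (≤-double _)))
    frontier-double (borrowed 1+z≡S _) z≡2a _ =
      contradiction (≤-trans (≤-reflexive (trans (cong suc (sym z≡2a)) 1+z≡S)) (sum-≤ _)) 1+n≰n
    frontier-double (untouched z≡S low) z≡2a pos =
      contradiction (trans low (sum-full t (trans (sym z≡S) z≡2a))) (>⇒≢ pos)
    frontier-double (received z≡1+S low) z≡2a _ =
      subst (_≤ a (1 + t)) (sym low) (sum-almost-full t (trans (sym z≡1+S) z≡2a))

    frontier-lower : Frontier t Z →
                     Z (1 + t) ≡ S (1 + t) ⊎ (suc (Z (2 + t)) ≡ a (2 + t) × Z (1 + t) ≡ suc (S (1 + t)))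
    frontier-lower (carried 1+z≡a z≡1+S) = inj₂ (1+z≡a , z≡1+S)
    frontier-lower (borrowed _ z≡S)    = inj₁ z≡S
    frontier-lower (untouched _ z≡S)   = inj₁ z≡S
    frontier-lower (received _ z≡S)    = inj₁ z≡S

  record Alg1Invariant (t : ℕ) (Z : Word) : Set where
    field
      bounded-above : ∀ i → 3 + t ≤ i → Z i ≤ a i
      top-max       : Z (3 + t) ≡ a (3 + t) → Z (2 + t) < a (2 + t)
      agrees-below  : ∀ i → i ≤ t → Z i ≡ S i
      frontier      : Frontier t Z

  RuleA1 : ℕ → Word → Set
  RuleA1 k Z = Z k < a k × a (k ∸ 1) < Z (k ∸ 1) × Z (k ∸ 2) ≡ 0

  RuleA2 : ℕ → Word → Set
  RuleA2 k Z = Z k < a k × a (k ∸ 1) ≤ Z (k ∸ 1) × Z (k ∸ 1) ≤ 2 * a (k ∸ 1) × 0 < Z (k ∸ 2)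

  ruleA1-reflects : ∀ k Z →
    Reflects (RuleA1 k Z) ((Z k <ᵇ a k) ∧ (a (k ∸ 1) <ᵇ Z (k ∸ 1)) ∧ (Z (k ∸ 2) ≡ᵇ 0))
  ruleA1-reflects k Z = <ᵇ-reflects-< _ _ ×-reflects <ᵇ-reflects-< _ _ ×-reflects ≡ᵇ-reflects-≡ _ _

  ruleA2-reflects : ∀ k Z →
    Reflects (RuleA2 k Z) ((Z k <ᵇ a k) ∧ (a (k ∸ 1) ≤ᵇ Z (k ∸ 1)) ∧ (Z (k ∸ 1) ≤ᵇ 2 * a (k ∸ 1))
                           ∧ (0 <ᵇ Z (k ∸ 2)))
  ruleA2-reflects k Z = <ᵇ-reflects-< _ _ ×-reflects ≤ᵇ-reflects-≤ _ _ ×-reflects ≤ᵇ-reflects-≤ _ _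
                          ×-reflects <ᵇ-reflects-< _ _

  AfterA1 : ℕ → Word → Word
  AfterA1 t Z =
    overwrite₄ t Z (Z (4 + t) + 1) (Z (3 + t) ∸ (a (3 + t) + 1)) (a (2 + t) ∸ 1) (Z (1 + t) + 1)

  AfterA2 : ℕ → Word → Word
  AfterA2 t Z = overwrite₃ (1 + t) Z (Z (4 + t) + 1) (Z (3 + t) ∸ a (3 + t)) (Z (2 + t) ∸ 1)

  stepA-A1 : ∀ t {Z} → RuleA1 (4 + t) Z → stepA a (4 + t) Z ≡ AfterA1 t Z
  stepA-A1 t {Z} = if-holds (ruleA1-reflects (4 + t) Z)

  stepA-A2 : ∀ t {Z} → ¬ RuleA1 (4 + t) Z → RuleA2 (4 + t) Z → stepA a (4 + t) Z ≡ AfterA2 t Z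
  stepA-A2 t {Z} ¬A1 A2 =
    trans (if-fails (ruleA1-reflects (4 + t) Z) ¬A1) (if-holds (ruleA2-reflects (4 + t) Z) A2)

  stepA-A3 : ∀ t {Z} → ¬ RuleA1 (4 + t) Z → ¬ RuleA2 (4 + t) Z → stepA a (4 + t) Z ≡ Z
  stepA-A3 t {Z} ¬A1 ¬A2 =
    trans (if-fails (ruleA1-reflects (4 + t) Z) ¬A1) (if-fails (ruleA2-reflects (4 + t) Z) ¬A2)

  module _ {t : ℕ} {Z : Word} (inv : Alg1Invariant (1 + t) Z) where
    open Alg1Invariant inv

    after-A1 : RuleA1 (4 + t) Z → Alg1Invariant t (AfterA1 t Z)
    after-A1 (z₄<a , _ , _) = record
      { bounded-above = bound-from
          (subst (_≤ a (3 + t)) (sym at₃) (∸-suc-≤-half (frontier-≤ frontier)))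
          (subst (_≤ a (4 + t)) (sym at₄) (<⇒+1≤ z₄<a))
          (λ i 4+t<i → outside i (inj₂ 4+t<i))
          bounded-above
      ; top-max = λ _ → subst (_< a (2 + t)) (sym at₂) (pred-< (a-pos (2 + t) (s≤s z≤n)) ≤-refl)
      ; agrees-below = λ i i≤t → trans (outside i (inj₁ i≤t)) (agrees-below i (m≤n⇒m≤1+n i≤t))
      ; frontier = carried (trans (cong suc at₂) (suc-∸1 (a-pos (2 + t) (s≤s z≤n))))
                           (trans at₁ (trans (+-comm (Z (1 + t)) 1)
                                             (cong suc (agrees-below (1 + t) ≤-refl))))
      }
      where
      open Overwritten₄ (overwrite₄-spec t Z (Z (4 + t) + 1) (Z (3 + t) ∸ (a (3 + t) + 1))
                                          (a (2 + t) ∸ 1) (Z (1 + t) + 1))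

    after-A2 : RuleA2 (4 + t) Z → Alg1Invariant t (AfterA2 t Z)
    after-A2 (z₄<a , a≤z₃ , z₃≤2a , z₂>0) = record
      { bounded-above = bound-from
          (subst (_≤ a (3 + t)) (sym at₂) (∸-≤-half z₃≤2a))
          (subst (_≤ a (4 + t)) (sym at₃) (<⇒+1≤ z₄<a))
          (λ i 4+t<i → outside i (inj₂ 4+t<i))
          bounded-above
      ; top-max = λ N₃≡a → subst (_< a (2 + t)) (sym at₁)
          (pred-< z₂>0 (frontier-double frontier (∸-≡⇒double a≤z₃ (trans (sym at₂) N₃≡a)) z₂>0))
      ; agrees-below = λ i i≤t →
          trans (outside i (inj₁ (m≤n⇒m≤1+n i≤t))) (agrees-below i (m≤n⇒m≤1+n i≤t))
      ; frontier = borrowed (trans (cong suc at₁) (trans (suc-∸1 z₂>0) z₂≡S))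
                            (trans (outside (1 + t) (inj₁ ≤-refl)) (agrees-below (1 + t) ≤-refl))
      }
      where
      open Overwritten₃ (overwrite₃-spec (1 + t) Z (Z (4 + t) + 1) (Z (3 + t) ∸ a (3 + t))
                                          (Z (2 + t) ∸ 1))
      -- rule A1 cannot have fired at the previous index, since Z (3+t) ≥ a (3+t)
      z₂≡S : Z (2 + t) ≡ S (2 + t)
      z₂≡S with frontier-lower frontier
      ... | inj₁ z≡S       = z≡S
      ... | inj₂ (1+z₃≡a , _) = contradiction (≤-trans (≤-reflexive 1+z₃≡a) a≤z₃) 1+n≰n

    after-A3 : ¬ RuleA1 (4 + t) Z → ¬ RuleA2 (4 + t) Z → Alg1Invariant t Z
    after-A3 ¬A1 ¬A2 = record
      { bounded-above = bound-from z₃≤a (bounded-above (4 + t) ≤-refl) (λ _ _ → refl) bounded-above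
      ; top-max = top-max′
      ; agrees-below = λ i i≤t → agrees-below i (m≤n⇒m≤1+n i≤t)
      ; frontier = frontier′
      }
      where
      -- otherwise rule A1 or A2 would have applied
      z₃≤a : Z (3 + t) ≤ a (3 + t)
      z₃≤a with m≤n⇒m<n∨m≡n (bounded-above (4 + t) ≤-refl) | Z (3 + t) ≤? a (3 + t)
      ... | inj₂ z₄≡a | _      = <⇒≤ (top-max z₄≡a)
      ... | inj₁ _ | yes z₃≤a′ = z₃≤a′
      ... | inj₁ z₄<a | no z₃≰a with Z (2 + t) ≟ 0
      ...   | yes z₂≡0 = contradiction (z₄<a , ≰⇒> z₃≰a , z₂≡0) ¬A1
      ...   | no z₂≢0  = contradiction (z₄<a , <⇒≤ (≰⇒> z₃≰a) ,
                           frontier-≤-double frontier (n≢0⇒n>0 z₂≢0) , n≢0⇒n>0 z₂≢0) ¬A2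

      top-max′ : Z (3 + t) ≡ a (3 + t) → Z (2 + t) < a (2 + t)
      top-max′ z₃≡a with m≤n⇒m<n∨m≡n (bounded-above (4 + t) ≤-refl) | Z (2 + t) ≟ 0
      ... | inj₂ z₄≡a | _   = contradiction z₃≡a (<⇒≢ (top-max z₄≡a))
      ... | inj₁ _ | yes z₂≡0 = subst (_< a (2 + t)) (sym z₂≡0) (a-pos (2 + t) (s≤s z≤n))
      ... | inj₁ z₄<a | no z₂≢0 = contradiction (z₄<a , ≤-reflexive (sym z₃≡a) ,
                                    ≤-trans (≤-reflexive z₃≡a) (≤-double _) , n≢0⇒n>0 z₂≢0) ¬A2

      frontier′ : Frontier t Z
      frontier′ with frontier-lower frontier
      ... | inj₁ z₂≡S          = untouched z₂≡S (agrees-below (1 + t) ≤-refl)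
      ... | inj₂ (_ , z₂≡1+S) = received z₂≡1+S (agrees-below (1 + t) ≤-refl)

  alg1-stepA : ∀ t {Z} → Alg1Invariant (1 + t) Z → Alg1Invariant t (stepA a (4 + t) Z)
  alg1-stepA t {Z} inv
    with _ because ruleA1-reflects (4 + t) Z | _ because ruleA2-reflects (4 + t) Z
  ... | yes A1 | _      = subst (Alg1Invariant t) (sym (stepA-A1 t A1)) (after-A1 inv A1)
  ... | no ¬A1 | yes A2 = subst (Alg1Invariant t) (sym (stepA-A2 t ¬A1 A2)) (after-A2 inv A2)
  ... | no ¬A1 | no ¬A2 = subst (Alg1Invariant t) (sym (stepA-A3 t ¬A1 ¬A2)) (after-A3 inv ¬A1 ¬A2)

  RuleB1 RuleB2 RuleB3 RuleB4 : Word → Set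
  RuleB1 Z = Z 3 < a 3 × a 2 < Z 2 × Z 1 ≡ 0
  RuleB2 Z = Z 3 < a 3 × a 2 ≤ Z 2 × Z 1 ≤ a 1 × 0 < Z 1
  RuleB3 Z = Z 3 < a 3 × a 2 ≤ Z 2 × a 1 < Z 1
  RuleB4 Z = Z 2 < a 2 × a 1 ≤ Z 1

  module _ (Z : Word) where
    ruleB1-reflects : Reflects (RuleB1 Z) ((Z 3 <ᵇ a 3) ∧ (a 2 <ᵇ Z 2) ∧ (Z 1 ≡ᵇ 0))
    ruleB1-reflects = <ᵇ-reflects-< _ _ ×-reflects <ᵇ-reflects-< _ _ ×-reflects ≡ᵇ-reflects-≡ _ _

    ruleB2-reflects : Reflects (RuleB2 Z) ((Z 3 <ᵇ a 3) ∧ (a 2 ≤ᵇ Z 2) ∧ (Z 1 ≤ᵇ a 1) ∧ (0 <ᵇ Z 1))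
    ruleB2-reflects = <ᵇ-reflects-< _ _ ×-reflects ≤ᵇ-reflects-≤ _ _ ×-reflects ≤ᵇ-reflects-≤ _ _
                        ×-reflects <ᵇ-reflects-< _ _

    ruleB3-reflects : Reflects (RuleB3 Z) ((Z 3 <ᵇ a 3) ∧ (a 2 ≤ᵇ Z 2) ∧ (a 1 <ᵇ Z 1))
    ruleB3-reflects = <ᵇ-reflects-< _ _ ×-reflects ≤ᵇ-reflects-≤ _ _ ×-reflects <ᵇ-reflects-< _ _

    ruleB4-reflects : Reflects (RuleB4 Z) ((Z 2 <ᵇ a 2) ∧ (a 1 ≤ᵇ Z 1))
    ruleB4-reflects = <ᵇ-reflects-< _ _ ×-reflects ≤ᵇ-reflects-≤ _ _

    stepB-B1 : RuleB1 Z → stepB a Z ≡ overwrite₃ 0 Z (Z 3 + 1) (Z 2 ∸ (a 2 + 1)) (a 1 ∸ 1)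
    stepB-B1 = if-holds ruleB1-reflects

    stepB-B2 : ¬ RuleB1 Z → RuleB2 Z → stepB a Z ≡ overwrite₃ 0 Z (Z 3 + 1) (Z 2 ∸ a 2) (Z 1 ∸ 1)
    stepB-B2 ¬B1 B2 = trans (if-fails ruleB1-reflects ¬B1) (if-holds ruleB2-reflects B2)

    stepB-B3 : ¬ RuleB1 Z → ¬ RuleB2 Z → RuleB3 Z →
               stepB a Z ≡ overwrite₃ 0 Z (Z 3 + 1) ((Z 2 ∸ a 2) + 1) ((Z 1 ∸ a 1) ∸ 1)
    stepB-B3 ¬B1 ¬B2 B3 =
      trans (if-fails ruleB1-reflects ¬B1)
        (trans (if-fails ruleB2-reflects ¬B2) (if-holds ruleB3-reflects B3))

    stepB-B4 : ¬ RuleB1 Z → ¬ RuleB2 Z → ¬ RuleB3 Z → RuleB4 Z →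
               stepB a Z ≡ overwrite₂ 0 Z (Z 2 + 1) (Z 1 ∸ a 1)
    stepB-B4 ¬B1 ¬B2 ¬B3 B4 =
      trans (if-fails ruleB1-reflects ¬B1) (trans (if-fails ruleB2-reflects ¬B2)
        (trans (if-fails ruleB3-reflects ¬B3) (if-holds ruleB4-reflects B4)))

    stepB-B5 : ¬ RuleB1 Z → ¬ RuleB2 Z → ¬ RuleB3 Z → ¬ RuleB4 Z → stepB a Z ≡ Z
    stepB-B5 ¬B1 ¬B2 ¬B3 ¬B4 =
      trans (if-fails ruleB1-reflects ¬B1) (trans (if-fails ruleB2-reflects ¬B2)
        (trans (if-fails ruleB3-reflects ¬B3) (if-fails ruleB4-reflects ¬B4)))

  module _ {Z : Word} (inv : Alg1Invariant 0 Z) where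
    open Alg1Invariant inv

    -- Rules B1–B3 overwrite positions 3, 2, 1; boundedness only depends on the values at 3, 2.
    after-B123 : ∀ {N c₃ c₂ c₁} → Overwritten₃ 0 Z N c₃ c₂ c₁ → c₃ ≤ a 3 → c₂ ≤ a 2 →
                 Bounded N
    after-B123 ow c₃≤a c₂≤a =
      bound-from (subst (_≤ a 2) (sym at₂) c₂≤a) (subst (_≤ a 3) (sym at₃) c₃≤a)
                 (λ i 3<i → outside i (inj₂ 3<i)) bounded-above
      where open Overwritten₃ ow

    after-B4 : Z 2 < a 2 → Bounded (overwrite₂ 0 Z (Z 2 + 1) (Z 1 ∸ a 1))
    after-B4 z₂<a =
      bound-from (subst (_≤ a 2) (sym at₂) (<⇒+1≤ z₂<a))
                 (subst (_≤ a 3) (sym (outside 3 (inj₂ ≤-refl))) (bounded-above 3 ≤-refl))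
                 (λ i 3<i → outside i (inj₂ (<⇒≤ 3<i))) bounded-above
      where open Overwritten₂ (overwrite₂-spec 0 Z (Z 2 + 1) (Z 1 ∸ a 1))

    -- If no rule applies, position 2 is already bounded (else B1, B2 or B3 would apply).
    after-B5 : ¬ RuleB1 Z → ¬ RuleB2 Z → ¬ RuleB3 Z → Bounded Z
    after-B5 ¬B1 ¬B2 ¬B3 = bound-from z₂≤a (bounded-above 3 ≤-refl) (λ _ _ → refl) bounded-above
      where
      z₂≤a : Z 2 ≤ a 2
      z₂≤a with m≤n⇒m<n∨m≡n (bounded-above 3 ≤-refl) | Z 2 ≤? a 2
      ... | inj₂ z₃≡a | _       = <⇒≤ (top-max z₃≡a)
      ... | inj₁ _ | yes z₂≤a′  = z₂≤a′
      ... | inj₁ z₃<a | no z₂≰a with Z 1 ≟ 0 | Z 1 ≤? a 1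
      ...   | yes z₁≡0 | _       = contradiction (z₃<a , ≰⇒> z₂≰a , z₁≡0) ¬B1
      ...   | no z₁≢0 | yes z₁≤a =
        contradiction (z₃<a , <⇒≤ (≰⇒> z₂≰a) , z₁≤a , n≢0⇒n>0 z₁≢0) ¬B2
      ...   | no _ | no z₁≰a     = contradiction (z₃<a , <⇒≤ (≰⇒> z₂≰a) , ≰⇒> z₁≰a) ¬B3

    alg1-stepB : Bounded (stepB a Z)
    alg1-stepB with _ because ruleB1-reflects Z | _ because ruleB2-reflects Z
                  | _ because ruleB3-reflects Z | _ because ruleB4-reflects Z
    ... | yes B1@(z₃<a , _ , _) | _ | _ | _ =
      subst Bounded (sym (stepB-B1 Z B1))
        (after-B123 (overwrite₃-spec 0 Z _ _ _) (<⇒+1≤ z₃<a) (∸-suc-≤-half (frontier-≤ frontier)))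
    ... | no ¬B1 | yes B2@(z₃<a , _ , _ , z₁>0) | _ | _ =
      subst Bounded (sym (stepB-B2 Z ¬B1 B2))
        (after-B123 (overwrite₃-spec 0 Z _ _ _) (<⇒+1≤ z₃<a)
                    (∸-≤-half (frontier-≤-double frontier z₁>0)))
    ... | no ¬B1 | no ¬B2 | yes B3@(z₃<a , a≤z₂ , a<z₁) | _ =
      subst Bounded (sym (stepB-B3 Z ¬B1 ¬B2 B3))
        (after-B123 (overwrite₃-spec 0 Z _ _ _) (<⇒+1≤ z₃<a) (∸-+1-≤-half a≤z₂ z₂<2a))
      where
      z₁>0 : 0 < Z 1
      z₁>0 = ≤-<-trans z≤n a<z₁
      z₂<2a : Z 2 < 2 * a 2
      z₂<2a = ≤∧≢⇒< (frontier-≤-double frontier z₁>0)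
                    (λ z₂≡2a → <⇒≱ a<z₁ (frontier-double frontier z₂≡2a z₁>0))
    ... | no ¬B1 | no ¬B2 | no ¬B3 | yes B4@(z₂<a , _) =
      subst Bounded (sym (stepB-B4 Z ¬B1 ¬B2 ¬B3 B4)) (after-B4 z₂<a)
    ... | no ¬B1 | no ¬B2 | no ¬B3 | no ¬B4 =
      subst Bounded (sym (stepB-B5 Z ¬B1 ¬B2 ¬B3 ¬B4)) (after-B5 ¬B1 ¬B2 ¬B3)

module Algorithms23 (a : ℕ → ℕ) (a-pos : ∀ i → 1 ≤ i → 1 ≤ a i) where
  open Digits a a-pos

  Fires : ℕ → Word → Set
  Fires k W = W k < a k × W (k ∸ 1) ≡ a (k ∸ 1) × 0 < W (k ∸ 2)

  fires-reflects : ∀ k W →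
    Reflects (Fires k W) ((W k <ᵇ a k) ∧ (W (k ∸ 1) ≡ᵇ a (k ∸ 1)) ∧ (0 <ᵇ W (k ∸ 2)))
  fires-reflects k W = <ᵇ-reflects-< _ _ ×-reflects ≡ᵇ-reflects-≡ _ _ ×-reflects <ᵇ-reflects-< _ _

  Fired : ℕ → Word → Word
  Fired t W = overwrite₃ t W (W (3 + t) + 1) 0 (W (1 + t) ∸ 1)

  step2-fires : ∀ t {W} → Fires (3 + t) W → step2 a (3 + t) W ≡ Fired t W
  step2-fires t {W} = if-holds (fires-reflects (3 + t) W)

  step2-skips : ∀ k {W} → ¬ Fires k W → step2 a k W ≡ W
  step2-skips k {W} = if-fails (fires-reflects k W)

  module FiredWord (t : ℕ) (W : Word) where
    open Overwritten₃ (overwrite₃-spec t W (W (3 + t) + 1) 0 (W (1 + t) ∸ 1)) public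
      renaming (at₃ to fired-at₃; at₂ to fired-at₂; at₁ to fired-at₁; outside to fired-outside)

    fired-at₁-not-max : Bounded W → 0 < W (1 + t) → 2 ≤ 1 + t → Fired t W (1 + t) ≢ a (1 + t)
    fired-at₁-not-max bnd pos 2≤1+t eq =
      <⇒≢ (pred-< pos (bnd (1 + t) 2≤1+t)) (trans (sym fired-at₁) eq)

    fired-bounded : Bounded W → W (3 + t) < a (3 + t) → Bounded (Fired t W)
    fired-bounded bnd lt i 2≤i = by-position (position t i) 2≤i
      where
      by-position : ∀ {i} → Position t i → 2 ≤ i → Fired t W i ≤ a i
      by-position (below i≤t) 2≤i = subst (_≤ _) (sym (fired-outside _ (inj₁ i≤t))) (bnd _ 2≤i)
      by-position (above 0) 2≤i = subst (_≤ _) (sym fired-at₁) (≤-trans (m∸n≤m _ 1) (bnd _ 2≤i))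
      by-position (above 1) _ = subst (_≤ _) (sym fired-at₂) z≤n
      by-position (above 2) _ = subst (_≤ _) (sym fired-at₃) (<⇒+1≤ lt)
      by-position (above (suc (suc (suc d)))) 2≤i =
        subst (_≤ _) (sym (fired-outside _ (inj₂ (+-monoʳ-≤ 4 (m≤n+m t d))))) (bnd _ 2≤i)

  open FiredWord using (fired-bounded)

  step2-bounded : ∀ t {W} → Bounded W → Bounded (step2 a (3 + t) W)
  step2-bounded t {W} bnd with _ because fires-reflects (3 + t) W
  ... | yes fires@(lt , _) = subst Bounded (sym (step2-fires t fires)) (fired-bounded t W bnd lt)
  ... | no  ¬fires         = subst Bounded (sym (step2-skips (3 + t) ¬fires)) bnd

  step2-settles : ∀ t W → ¬ Fires (3 + t) (step2 a (3 + t) W)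
  step2-settles t W with _ because fires-reflects (3 + t) W
  ... | yes fires = subst (λ N → ¬ Fires (3 + t) N) (sym (step2-fires t fires))
                      λ (_ , max , _) →
                        zero-not-max (s≤s z≤n) (trans (sym (FiredWord.fired-at₂ t W)) max)
  ... | no ¬fires = subst (λ N → ¬ Fires (3 + t) N) (sym (step2-skips (3 + t) ¬fires)) ¬fires

  pattern-after-fire : ∀ {t W} j → Bounded W → Fires (3 + t) W → 4 ≤ j →
                       Pattern (Fired t W) j → Pattern W j ⊎ (j ≡ 6 + t × Pattern W (4 + t))
  pattern-after-fire {t} {W} j bnd (lt , max , pos) 4≤j = by-position (position t j) 4≤j
    where
    open FiredWord t W
    by-position : ∀ {j} → Position t j → 4 ≤ j → Pattern (Fired t W) j →
                  Pattern W j ⊎ (j ≡ 6 + t × Pattern W (4 + t))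
    by-position {j} (below j≤t) _ pat =
      inj₁ (pattern-transport (Fired t W) W j
              (λ d _ → fired-outside _ (inj₁ (≤-trans (m∸n≤m j d) j≤t))) pat)
    by-position (above 0) 4≤1+t (max₀ , _) =
      contradiction max₀ (fired-at₁-not-max bnd pos (≤-trans (s≤s (s≤s z≤n)) 4≤1+t))
    by-position (above 1) _ (max₀ , _) =
      contradiction (trans (sym fired-at₂) max₀) (zero-not-max (s≤s z≤n))
    by-position (above 2) 4≤3+t (_ , _ , max₂ , _) =
      contradiction max₂ (fired-at₁-not-max bnd pos (s≤s⁻¹ (s≤s⁻¹ 4≤3+t)))
    by-position (above 3) _ (_ , _ , max₂ , _) =
      contradiction (trans (sym fired-at₂) max₂) (zero-not-max (s≤s z≤n))
    by-position (above 4) _ (_ , _ , _ , pos₃) = contradiction pos₃ (<-irrefl (sym fired-at₂))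
    by-position (above 5) _ (_ , _ , max₂ , _) =
      inj₂ (refl , trans (sym (fired-outside _ (inj₂ ≤-refl))) max₂ , lt , max , pos)
    by-position {j} (above (suc (suc (suc (suc (suc (suc d))))))) _ pat =
      inj₁ (pattern-transport (Fired t W) W j (λ e e≤3 → fired-outside _ (inj₂ (above-window e e≤3))) pat)
      where
      above-window : ∀ e → e ≤ 3 → 3 + t < j ∸ e
      above-window e e≤3 = <-≤-trans (+-monoʳ-< 3 (s≤s (m≤n+m t d))) (∸-monoʳ-≤ j e≤3)

  pattern-after-step2 : ∀ t {W} j → Bounded W → 4 ≤ j → Pattern (step2 a (3 + t) W) j →
                        Pattern W j ⊎ (j ≡ 6 + t × Pattern W (4 + t))
  pattern-after-step2 t {W} j bnd 4≤j pat with _ because fires-reflects (3 + t) W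
  ... | yes fires =
    pattern-after-fire j bnd fires 4≤j (subst (λ N → Pattern N j) (step2-fires t fires) pat)
  ... | no ¬fires = inj₁ (subst (λ N → Pattern N j) (step2-skips (3 + t) ¬fires) pat)

  alg2-step : ∀ t {W} → Clean (2 + t) W → ¬ Fires (2 + t) W → Clean (3 + t) (step2 a (3 + t) W)
  alg2-step t {W} (bnd , free) settled = step2-bounded t bnd , free′
    where
    free′ : PatternFree (3 + t) (step2 a (3 + t) W)
    free′ j 4≤j j≤3+t pat with pattern-after-step2 t j bnd 4≤j pat
    ... | inj₂ (refl , _) =
      contradiction (+-cancelʳ-≤ t 6 3 j≤3+t) (<⇒≱ (s≤s (s≤s (s≤s (s≤s z≤n)))))
    ... | inj₁ patW with m≤n⇒m<n∨m≡n j≤3+t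
    ...   | inj₁ j<3+t = free j 4≤j (s≤s⁻¹ j<3+t) patW
    ...   | inj₂ refl  = settled (proj₂ patW)

  alg3-step : ∀ t {M W} → Clean M W → Clean M (step2 a (3 + t) W)
  alg3-step t {M} {W} (bnd , free) = step2-bounded t bnd , free′
    where
    free′ : PatternFree M (step2 a (3 + t) W)
    free′ j 4≤j j≤M pat with pattern-after-step2 t j bnd 4≤j pat
    ... | inj₁ patW = free j 4≤j j≤M patW
    ... | inj₂ (refl , patW) =
      free (4 + t) (+-monoʳ-≤ 4 z≤n) (≤-trans (+-monoˡ-≤ t (n≤1+n 4)) (≤-trans (n≤1+n _) j≤M)) patW

module Execution (a : ℕ → ℕ) (a-pos : ∀ i → 1 ≤ i → 1 ≤ a i) where
  open Digits a a-pos
  open Algorithms23 a a-pos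

  -- For n = 2+n', Algorithm 1 performs the steps at indices 2+n', …, 4 (rules A) and then 3.
  module Algorithm1Run (n' : ℕ) (x y : Word) (sum : DigitSum a (sumWord (2 + n') x y)) where
    open Algorithm1 a a-pos (sumWord (2 + n') x y) sum

    -- Before any step, s itself satisfies the invariant: it vanishes above position 2+n'.
    initial : Alg1Invariant n' (sumWord (2 + n') x y)
    initial = record
      { bounded-above = λ i 3+n'≤i →
          subst (_≤ a i) (sym (trunc-outside (2 + n') (λ j → x j + y j) 3+n'≤i)) z≤n
      ; top-max = λ s≡a → contradiction (trans (sym (trunc-outside (2 + n') (λ j → x j + y j) ≤-refl)) s≡a)
                                        (<⇒≢ (a-pos (3 + n') (s≤s z≤n)))
      ; agrees-below = λ _ _ → refl
      ; frontier = untouched refl refl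
      }

    iterate : ∀ j r → j + r ≡ n' → Alg1Invariant r (zIter a (2 + n') x y j)
    iterate zero r refl = initial
    iterate (suc j) r 1+j+r≡n' =
      subst (λ k → Alg1Invariant r (step1 a k (zIter a (2 + n') x y j))) (sym index)
            (alg1-stepA r (iterate j (suc r) j+1+r≡n'))
      where
      j+1+r≡n' : j + suc r ≡ n'
      j+1+r≡n' = trans (+-suc j r) 1+j+r≡n'
      index : 3 + n' ∸ j ≡ 4 + r
      index = trans (cong (λ n″ → 3 + n″ ∸ j) (sym j+1+r≡n')) (offset-∸ 3 j (suc r))

    z₃-bounded : Bounded (z3 a (2 + n') x y)
    z₃-bounded = subst (λ k → Bounded (step1 a k (zIter a (2 + n') x y n'))) (sym (m+n∸n≡m 3 n'))
                       (alg1-stepB (iterate n' 0 (+-identityʳ n')))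

  -- Algorithm 1 produces a word bounded from position 2 on (for n ≤ 1 it does nothing,
  -- and s vanishes from position 2 on).
  z₃-bounded : ∀ n x y → DigitSum a (sumWord n x y) → Bounded (z3 a n x y)
  z₃-bounded zero x y _ i 2≤i =
    subst (_≤ a i) (sym (trunc-outside 0 (λ j → x j + y j) (≤-trans (s≤s z≤n) 2≤i))) z≤n
  z₃-bounded (suc zero) x y _ i 2≤i =
    subst (_≤ a i) (sym (trunc-outside 1 (λ j → x j + y j) 2≤i)) z≤n
  z₃-bounded (suc (suc n')) x y sum = Algorithm1Run.z₃-bounded n' x y sum

  module Algorithms23Run (n : ℕ) (x y : Word) (sum : DigitSum a (sumWord n x y)) where
    w-clean : ∀ j → Clean (2 + j) (wIter a n x y j) × ¬ Fires (2 + j) (wIter a n x y j)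
    w-clean zero = (trunc-bounded (suc n) (z₃-bounded n x y sum) , nothing-below-4) , λ { (_ , _ , ()) }
      where
      nothing-below-4 : PatternFree 2 (wIter a n x y 0)
      nothing-below-4 j 4≤j j≤2 _ = <⇒≱ (s≤s (s≤s (s≤s z≤n))) (≤-trans 4≤j j≤2)
    w-clean (suc j) = alg2-step j (proj₁ (w-clean j)) (proj₂ (w-clean j)) , step2-settles j (wIter a n x y j)

    -- Algorithm 3 starts from the truncated output of Algorithm 2, which is clean up to
    -- m+2 = n+3 (position n+3 is 0), and each of its steps keeps the word clean.
    v-clean : ∀ j → j ≤ suc n → Clean (suc n + 2) (vIter a n x y j)
    v-clean zero _ = trunc-bounded (suc n + 1) (proj₁ w-last-clean) , start-free
      where
      w-last-clean : Clean (2 + n) (wLast a n x y)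
      w-last-clean = proj₁ (w-clean n)
      start-free : PatternFree (suc n + 2) (vIter a n x y 0)
      start-free j 4≤j j≤n+3 pat with m≤n⇒m<n∨m≡n j≤n+3
      ... | inj₁ (s≤s j≤n+2) =
        proj₂ w-last-clean j 4≤j (≤-trans j≤n+2 (≤-reflexive (+-comm n 2)))
          (trunc-pattern (suc n + 1) (wLast a n x y) j 4≤j (≤-trans j≤n+2 (≤-reflexive (+-suc n 1))) pat)
      ... | inj₂ refl =
        contradiction (trans (sym (trunc-outside (suc n + 1) (wLast a n x y) (+-monoʳ-< (suc n) ≤-refl)))
                             (proj₁ pat))
                      (<⇒≢ (a-pos (suc n + 2) (s≤s z≤n)))
    v-clean (suc j) 1+j≤1+n =
      subst (λ k → Clean (suc n + 2) (step2 a k (vIter a n x y j))) (sym index)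
            (alg3-step (n ∸ j) (v-clean j (≤-trans (n≤1+n j) 1+j≤1+n)))
      where
      index : suc n + 2 ∸ j ≡ 3 + (n ∸ j)
      index = trans (cong (_∸ j) (+-comm (suc n) 2)) (+-∸-assoc 3 (s≤s⁻¹ 1+j≤1+n))

mainTheorem8 : (a : ℕ → ℕ) → (∀ i → 1 ≤ i → 1 ≤ a i) →
    (n M N : ℕ) (x y : Word) →
    OstrowskiRep a n x M → OstrowskiRep a n y N →
    ∀ l → 3 ≤ l → l ≤ suc n + 3 →
    ¬ (Σ ℕ λ k → 4 ≤ k × k ≤ suc n + 2 ×
        v a n x y l k ≡ a k × v a n x y l (k ∸ 1) < a (k ∸ 1) ×
        v a n x y l (k ∸ 2) ≡ a (k ∸ 2) × 0 < v a n x y l (k ∸ 3))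
mainTheorem8 a a-pos n M N x y ox oy l 3≤l _ (k , 4≤k , k≤n+3 , pat) =
  proj₂ (Execution.Algorithms23Run.v-clean a a-pos n x y digit-sum (suc n + 3 ∸ l) steps-done)
        k 4≤k k≤n+3 pat
  where
  digit-sum : DigitSum a (sumWord n x y)
  digit-sum = admissible-sum (ostrowski-admissible a-pos ox) (ostrowski-admissible a-pos oy)
                             (sumWord-split n x y)
  steps-done : suc n + 3 ∸ l ≤ suc n
  steps-done = ≤-trans (∸-monoʳ-≤ (suc n + 3) 3≤l) (≤-reflexive (m+n∸n≡m (suc n) 3))
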